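{- Let $G$ be a finite abelian group of order $n$ and $H$ a finite abelian group of order $m$. Let $p$ be a prime and write $n=p^\alpha n'$, $m=p^\gamma m'$ with $\gcd(n',p)=\gcd(m',p)=1$. Let $$\mathcal E=\{k\in\mathbb N : p^k\mid\gcd(m,n),\ \varphi_G(p^k)\ne\varphi_H(p^k)\}.$$ Suppose $\mathcal E$ is nonempty and let $s=\min\mathcal E$. Assume that (1) $s\ge 2$; (2) $p^{s+1}\mid\gcd(m,n)$; (3) $\varphi_G(p^s)>\varphi_H(p^s)$ but $\varphi_G(p^{s+1})<\varphi_H(p^{s+1})$. Then $\alpha\ge s+2$ and $\gamma\ge s+2$.
   Context: $\mathbb N$ denotes the set of positive integers. For a finite group $G$ and positive integer $d$, $\varphi_G(d)$ denotes the number of elements of $G$ of order exactly $d$. -}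

module Defs where

open import Data.Nat using (ℕ; zero; suc; _≤_; _≤?_)
open import Data.Fin using (Fin; toℕ)
open import Data.Fin.Properties using (all?) renaming (_≟_ to _≟F_)
open import Data.List using (List; length; filter)
open import Data.List using () renaming (allFin to allFin)
open import Data.Product using (_×_)
open import Relation.Nullary using (Dec; ¬_; ¬?; _×-dec_; _→-dec_)
open import Relation.Binary.PropositionalEquality using (_≡_)
open import Algebra.Structures using (IsAbelianGroup)

-- A finite abelian group of order n, represented (up to isomorphism) with
-- carrier Fin n and propositional equality.
record FinAbGroup (n : ℕ) : Set where
  field
    _∙_ : Fin n → Fin n → Fin n
    ε : Fin n
    _⁻¹ : Fin n → Fin n
    isAbelianGroup : IsAbelianGroup _≡_ _∙_ ε _⁻¹

module _ {n : ℕ} (G : FinAbGroup n) where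
  open FinAbGroup G

  pow : Fin n → ℕ → Fin n
  pow g zero = ε
  pow g (suc k) = g ∙ pow g k

  HasOrder : Fin n → ℕ → Set
  HasOrder g d = (1 ≤ d) × (pow g d ≡ ε) × ((k : Fin d) → 1 ≤ toℕ k → ¬ (pow g (toℕ k) ≡ ε))

  hasOrder? : (d : ℕ) (g : Fin n) → Dec (HasOrder g d)
  hasOrder? d g = (1 ≤? d) ×-dec ((pow g d ≟F ε) ×-dec
                   all? (λ k → (1 ≤? toℕ k) →-dec ¬? (pow g (toℕ k) ≟F ε)))

  φ : ℕ → ℕ
  φ d = length (filter (hasOrder? d) (allFin n))

-- Take g ∈ G of order p^s and h ∈ H of order p^(s+1), as provided by (3), and put b = h^p, of order p^s;
-- minimality of s gives φ_G(p) = φ_H(p). Internal direct products ⟨g⟩ × ⟨x⟩ ⊆ G and ⟨b⟩ × ⟨x′⟩ ⊆ H with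
-- factors of the same orders match element orders, so if every element of order p^s of G lay in such a
-- product we would get φ_G(p^s) ≤ φ_H(p^s), against (3). If every element of order p of G were in ⟨g⟩, so
-- would be every element killed by p^s; hence some x of order p lies outside ⟨g⟩, and counting elements of
-- order p inside and outside ⟨g⟩ and ⟨b⟩ yields such an x′ ∉ ⟨b⟩ in H. Then some element of order p^s of G
-- lies outside K = ⟨g⟩ × ⟨x⟩, so a power w of it has w ∉ K, w^p ∈ K, and ⟨K, w⟩ is a subgroup of order
-- p^(s+2). In H, h ∉ ⟨b⟩ × ⟨x′⟩ (whose exponent is p^s) while h^p = b is in it, which gives a subgroup of
-- order p^(s+2) again. Lagrange's theorem turns both subgroups into p^(s+2) ∣ n and p^(s+2) ∣ m.

module Submission where

open import Defs
open import Level using (0ℓ)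
open import Data.Nat
  using (ℕ; zero; suc; _+_; _*_; _^_; _∸_; _≤_; _<_; z≤n; s≤s; s≤s⁻¹; NonZero; >-nonZero; >-nonZero⁻¹; nonTrivial⇒≢1)
open import Data.Nat.Properties hiding (_≟_; suc-injective)
open import Data.Nat.Divisibility
open import Data.Nat.DivMod
open import Data.Nat.GCD using (gcd; module Bézout)
open import Data.Nat.Coprimality using (Coprime; coprime-Bézout)
open import Data.Nat.Primality using (Prime; prime⇒irreducible; prime⇒nonZero; prime⇒nonTrivial)
open import Data.Fin using (Fin; zero; suc; toℕ; fromℕ<; remQuot; combine)
open import Data.Fin.Properties
  using (any?; _≟_; suc-injective; toℕ<n; toℕ-fromℕ<; toℕ-injective; remQuot-combine; combine-remQuot)
open import Data.Fin.Permutation using (permutation)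
open import Data.List using (length; filter; tabulate)
open import Data.Product using (_×_; _,_; proj₁; proj₂; ∃; uncurry)
open import Data.Sum using (inj₁; inj₂)
open import Data.Empty using (⊥-elim)
open import Data.Unit using (⊤; tt)
open import Function using (id; _∘_; _⇔_; mk⇔; Equivalence)
import Function.Properties.Equivalence as ⇔
open import Relation.Nullary using (Dec; yes; no; ¬_; ¬?; _×-dec_)
open import Relation.Nullary.Decidable using (decidable-stable)
open import Relation.Unary using (Decidable)
open import Relation.Binary.PropositionalEquality
open import Algebra.Bundles using (AbelianGroup)
open import Algebra.Properties.CommutativeMonoid.Sum +-0-commutativeMonoid
  using (sum; sum-cong-≗; ∑-comm; ∑-distrib-+; sum-permute)

-- Counting over Fin N

χ : ∀ {a} {P : Set a} → Dec P → ℕ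
χ (yes _) = 1
χ (no _) = 0

module _ {a b} {P : Set a} {Q : Set b} where

  χ-cong : (P → Q) → (Q → P) → (P? : Dec P) (Q? : Dec Q) → χ P? ≡ χ Q?
  χ-cong f g (yes p) (yes q) = refl
  χ-cong f g (yes p) (no ¬q) = ⊥-elim (¬q (f p))
  χ-cong f g (no ¬p) (yes q) = ⊥-elim (¬p (g q))
  χ-cong f g (no ¬p) (no ¬q) = refl

  χ-mono : (P → Q) → (P? : Dec P) (Q? : Dec Q) → χ P? ≤ χ Q?
  χ-mono f (yes p) (yes q) = ≤-refl
  χ-mono f (yes p) (no ¬q) = ⊥-elim (¬q (f p))
  χ-mono f (no ¬p) Q? = z≤n

  χ-split : (P? : Dec P) (Q? : Dec Q) → χ P? ≡ χ (P? ×-dec Q?) + χ (P? ×-dec ¬? Q?)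
  χ-split (yes p) (yes q) = refl
  χ-split (yes p) (no ¬q) = refl
  χ-split (no ¬p) Q? = refl

module _ {a} {P : Set a} where

  χ-yes : P → (P? : Dec P) → χ P? ≡ 1
  χ-yes p (yes _) = refl
  χ-yes p (no ¬p) = ⊥-elim (¬p p)

  χ-no : ¬ P → (P? : Dec P) → χ P? ≡ 0
  χ-no ¬p (yes p) = ⊥-elim (¬p p)
  χ-no ¬p (no _) = refl

  χ-pos : (P? : Dec P) → 0 < χ P? → P
  χ-pos (yes p) _ = p

sum-mono : ∀ {n} {f g : Fin n → ℕ} → (∀ i → f i ≤ g i) → sum f ≤ sum g
sum-mono {zero} f≤g = ≤-refl
sum-mono {suc n} f≤g = +-mono-≤ (f≤g zero) (sum-mono (λ i → f≤g (suc i)))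

sum-zero : ∀ {n} {f : Fin n → ℕ} → (∀ i → f i ≡ 0) → sum f ≡ 0
sum-zero {zero} f≡0 = refl
sum-zero {suc n} f≡0 = cong₂ _+_ (f≡0 zero) (sum-zero (λ i → f≡0 (suc i)))

sum-const : ∀ n c → sum {n} (λ _ → c) ≡ n * c
sum-const zero c = refl
sum-const (suc n) c = cong (c +_) (sum-const n c)

sum-single : ∀ {n} {f : Fin n → ℕ} k → (∀ i → i ≢ k → f i ≡ 0) → sum f ≡ f k
sum-single {suc n} {f} zero f≡0 = begin
  f zero + sum (λ i → f (suc i)) ≡⟨ cong (f zero +_) (sum-zero (λ i → f≡0 (suc i) λ ())) ⟩
  f zero + 0                      ≡⟨ +-identityʳ (f zero) ⟩
  f zero                          ∎
  where open ≡-Reasoning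
sum-single {suc n} {f} (suc k) f≡0 =
  cong₂ _+_ (f≡0 zero λ ()) (sum-single k (λ i i≢k → f≡0 (suc i) (i≢k ∘ suc-injective)))

sum-pos : ∀ {n} (f : Fin n → ℕ) → 0 < sum f → ∃ λ i → 0 < f i
sum-pos {suc n} f 0<Σ with f zero in eq
... | suc _ = zero , subst (0 <_) (sym eq) (s≤s z≤n)
... | zero with sum-pos (λ i → f (suc i)) 0<Σ
...   | i , 0<fi = suc i , 0<fi

≤-sum : ∀ {n} (f : Fin n → ℕ) i → f i ≤ sum f
≤-sum f zero = m≤m+n _ _
≤-sum f (suc i) = ≤-trans (≤-sum (λ j → f (suc j)) i) (m≤n+m _ _)

length-filter-tabulate : ∀ {n} {A : Set} {P : A → Set} (P? : Decidable P) (f : Fin n → A) →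
  length (filter P? (tabulate f)) ≡ sum (λ i → χ (P? (f i)))
length-filter-tabulate {zero} P? f = refl
length-filter-tabulate {suc n} P? f with P? (f zero)
... | yes _ = cong suc (length-filter-tabulate P? (λ i → f (suc i)))
... | no _ = length-filter-tabulate P? (λ i → f (suc i))

module _ {N : ℕ} where

  count : {A : Fin N → Set} → Decidable A → ℕ
  count A? = sum (λ z → χ (A? z))

  module _ {A B : Fin N → Set} (A? : Decidable A) (B? : Decidable B) where

    count-cong : (∀ z → A z → B z) → (∀ z → B z → A z) → count A? ≡ count B?
    count-cong A⇒B B⇒A = sum-cong-≗ (λ z → χ-cong (A⇒B z) (B⇒A z) (A? z) (B? z))

    count-mono : (∀ z → A z → B z) → count A? ≤ count B?
    count-mono A⇒B = sum-mono (λ z → χ-mono (A⇒B z) (A? z) (B? z))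

    count-split : count A? ≡ count (λ z → A? z ×-dec B? z) + count (λ z → A? z ×-dec ¬? (B? z))
    count-split = trans (sum-cong-≗ (λ z → χ-split (A? z) (B? z)))
      (∑-distrib-+ (λ z → χ (A? z ×-dec B? z)) (λ z → χ (A? z ×-dec ¬? (B? z))))

  module _ {A : Fin N → Set} (A? : Decidable A) where

    count-zero : (∀ z → ¬ A z) → count A? ≡ 0
    count-zero ¬A = sum-zero (λ z → χ-no (¬A z) (A? z))

    count-pos : 0 < count A? → ∃ A
    count-pos 0<count with sum-pos _ 0<count
    ... | z , 0<χ = z , χ-pos (A? z) 0<χ

    count-≥1 : ∀ z → A z → 1 ≤ count A?
    count-≥1 z a = subst (_≤ count A?) (χ-yes a (A? z)) (≤-sum _ z)

  count-all : count {A = λ _ → ⊤} (λ _ → yes tt) ≡ N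
  count-all = trans (sum-const N 1) (*-identityʳ N)

χ-any?-unique : ∀ {n} {Q : Fin n → Set} (Q? : Decidable Q) → (∀ i j → Q i → Q j → i ≡ j) →
  χ (any? Q?) ≡ sum (λ i → χ (Q? i))
χ-any?-unique Q? unique with any? Q?
... | yes (i , qi) = sym (trans (sum-single i (λ j j≢i → χ-no (λ qj → j≢i (unique j i qj qi)) (Q? j)))
                                (χ-yes qi (Q? i)))
... | no ¬∃ = sym (sum-zero (λ j → χ-no (λ qj → ¬∃ (j , qj)) (Q? j)))

module _ {A N : ℕ} (f : Fin A → Fin N) where

  Image : Fin N → Set
  Image z = ∃ λ k → z ≡ f k

  image? : Decidable Image
  image? z = any? (λ k → z ≟ f k)

  count-∩-image : (∀ k k′ → f k ≡ f k′ → k ≡ k′) → {Q : Fin N → Set} (Q? : Decidable Q) →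
    count (λ z → Q? z ×-dec image? z) ≡ sum (λ k → χ (Q? (f k)))
  count-∩-image f-inj {Q} Q? = begin
    sum (λ z → χ (Q? z ×-dec image? z))
      ≡⟨ sum-cong-≗ (λ z → trans (χ-cong swap swap⁻¹ (Q? z ×-dec image? z) (any? (Q?′ z)))
                                   (χ-any?-unique (Q?′ z) (λ { k k′ (refl , _) (eq , _) → f-inj k k′ eq }))) ⟩
    sum (λ z → sum (λ k → χ (Q?′ z k)))
      ≡⟨ ∑-comm (λ z k → χ (Q?′ z k)) ⟩
    sum (λ k → sum (λ z → χ (Q?′ z k)))
      ≡⟨ sum-cong-≗ (λ k → trans (sum-single (f k) (λ z z≢fk → χ-no (λ (eq , _) → z≢fk eq) (Q?′ z k)))
                                   (χ-cong proj₂ (refl ,_) (Q?′ (f k) k) (Q? (f k)))) ⟩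
    sum (λ k → χ (Q? (f k))) ∎
    where
    open ≡-Reasoning
    Q?′ : ∀ z k → Dec (z ≡ f k × Q (f k))
    Q?′ z k = (z ≟ f k) ×-dec Q? (f k)
    swap : ∀ {z} → Q z × Image z → ∃ λ k → z ≡ f k × Q (f k)
    swap (q , k , refl) = k , refl , q
    swap⁻¹ : ∀ {z} → (∃ λ k → z ≡ f k × Q (f k)) → Q z × Image z
    swap⁻¹ (k , refl , q) = q , k , refl

  count-image : (∀ k k′ → f k ≡ f k′ → k ≡ k′) → count image? ≡ A
  count-image f-inj = begin
    count image?
      ≡⟨ count-cong image? (λ z → yes tt ×-dec image? z) (λ _ → tt ,_) (λ _ → proj₂) ⟩
    count (λ z → yes tt ×-dec image? z)             ≡⟨ count-∩-image f-inj (λ _ → yes tt) ⟩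
    sum {A} (λ _ → 1)                               ≡⟨ sum-const A 1 ⟩
    A * 1                                           ≡⟨ *-identityʳ A ⟩
    A                                               ∎
    where open ≡-Reasoning

m+m*[n∸1]≡m*n : ∀ m n .{{_ : NonZero n}} → m + m * (n ∸ 1) ≡ m * n
m+m*[n∸1]≡m*n m (suc n) = sym (*-suc m n)

prime∤⇒coprime : ∀ {p j} → Prime p → ¬ p ∣ j → Coprime j p
prime∤⇒coprime p-prime p∤j (d∣j , d∣p) with prime⇒irreducible p-prime d∣p
... | inj₁ d≡1 = d≡1
... | inj₂ refl = ⊥-elim (p∤j d∣j)

pᵏ∣pᵅ*n′⇒k≤α : ∀ {p n′} → Prime p → Coprime n′ p → ∀ k α → p ^ k ∣ p ^ α * n′ → k ≤ α
pᵏ∣pᵅ*n′⇒k≤α p-prime n′⊥p zero α _ = z≤n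
pᵏ∣pᵅ*n′⇒k≤α {p} {n′} p-prime n′⊥p (suc k) zero pᵏ⁺¹∣n′ =
  ⊥-elim (nonTrivial⇒≢1 {{prime⇒nonTrivial p-prime}} (n′⊥p (p∣n′ , ∣-refl)))
  where
  p∣n′ : p ∣ n′
  p∣n′ = ∣-trans (m∣m*n (p ^ k)) (subst (p ^ suc k ∣_) (+-identityʳ n′) pᵏ⁺¹∣n′)
pᵏ∣pᵅ*n′⇒k≤α {p} p-prime n′⊥p (suc k) (suc α) pᵏ⁺¹∣ = s≤s (pᵏ∣pᵅ*n′⇒k≤α p-prime n′⊥p k α
  (*-cancelˡ-∣ p {{prime⇒nonZero p-prime}} (subst (p * p ^ k ∣_) (*-assoc p (p ^ α) _) pᵏ⁺¹∣)))

-- Finite abelian groups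

module GroupTheory {N : ℕ} (G : FinAbGroup N) where

  abelianGroup : AbelianGroup 0ℓ 0ℓ
  abelianGroup = record
    { Carrier = Fin N ; _≈_ = _≡_ ; _∙_ = FinAbGroup._∙_ G ; ε = FinAbGroup.ε G
    ; _⁻¹ = FinAbGroup._⁻¹ G ; isAbelianGroup = FinAbGroup.isAbelianGroup G }

  open AbelianGroup abelianGroup public
    using (_∙_; ε; _⁻¹; assoc; comm; identityˡ; identityʳ; inverseˡ; inverseʳ)
  open import Algebra.Properties.AbelianGroup abelianGroup
  open import Algebra.Properties.CommutativeSemigroup (AbelianGroup.commutativeSemigroup abelianGroup)
    using (interchange)
  open ≡-Reasoning

  -- Binds looser than ℕ's _^_, so g ^ᵍ p ^ k is g ^ᵍ (p ^ k).
  infixl 7.5 _^ᵍ_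
  _^ᵍ_ : Fin N → ℕ → Fin N
  _^ᵍ_ = pow G

  ^ᵍ-identityʳ : ∀ g → g ^ᵍ 1 ≡ g
  ^ᵍ-identityʳ = identityʳ

  ^ᵍ-distribˡ-+ : ∀ g a b → g ^ᵍ (a + b) ≡ g ^ᵍ a ∙ g ^ᵍ b
  ^ᵍ-distribˡ-+ g zero b = sym (identityˡ _)
  ^ᵍ-distribˡ-+ g (suc a) b = trans (cong (g ∙_) (^ᵍ-distribˡ-+ g a b)) (sym (assoc _ _ _))

  ^ᵍ-*-assoc : ∀ g a b → (g ^ᵍ a) ^ᵍ b ≡ g ^ᵍ (a * b)
  ^ᵍ-*-assoc g a zero = cong (g ^ᵍ_) (sym (*-zeroʳ a))
  ^ᵍ-*-assoc g a (suc b) = begin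
    g ^ᵍ a ∙ (g ^ᵍ a) ^ᵍ b  ≡⟨ cong (g ^ᵍ a ∙_) (^ᵍ-*-assoc g a b) ⟩
    g ^ᵍ a ∙ g ^ᵍ (a * b)   ≡⟨ ^ᵍ-distribˡ-+ g a (a * b) ⟨
    g ^ᵍ (a + a * b)        ≡⟨ cong (g ^ᵍ_) (*-suc a b) ⟨
    g ^ᵍ (a * suc b)        ∎

  ^ᵍ-comm : ∀ g a b → (g ^ᵍ a) ^ᵍ b ≡ (g ^ᵍ b) ^ᵍ a
  ^ᵍ-comm g a b = trans (^ᵍ-*-assoc g a b) (trans (cong (g ^ᵍ_) (*-comm a b)) (sym (^ᵍ-*-assoc g b a)))

  ε^n≡ε : ∀ n → ε ^ᵍ n ≡ ε
  ε^n≡ε zero = refl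
  ε^n≡ε (suc n) = trans (identityˡ _) (ε^n≡ε n)

  ^ᵍ-distribʳ-∙ : ∀ x y n → (x ∙ y) ^ᵍ n ≡ x ^ᵍ n ∙ y ^ᵍ n
  ^ᵍ-distribʳ-∙ x y zero = sym (identityˡ ε)
  ^ᵍ-distribʳ-∙ x y (suc n) = trans (cong (x ∙ y ∙_) (^ᵍ-distribʳ-∙ x y n)) (interchange x y _ _)

  ⁻¹-^ᵍ-comm : ∀ x n → x ⁻¹ ^ᵍ n ≡ (x ^ᵍ n) ⁻¹
  ⁻¹-^ᵍ-comm x zero = sym ε⁻¹≈ε
  ⁻¹-^ᵍ-comm x (suc n) = trans (cong (x ⁻¹ ∙_) (⁻¹-^ᵍ-comm x n)) (⁻¹-∙-comm x _)

  ∣⇒^ᵍ≡ε : ∀ {g d c} → g ^ᵍ d ≡ ε → d ∣ c → g ^ᵍ c ≡ ε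
  ∣⇒^ᵍ≡ε {g} {d} gᵈ≡ε (divides-refl q) = begin
    g ^ᵍ (q * d)    ≡⟨ cong (g ^ᵍ_) (*-comm q d) ⟩
    g ^ᵍ (d * q)    ≡⟨ ^ᵍ-*-assoc g d q ⟨
    (g ^ᵍ d) ^ᵍ q   ≡⟨ cong (_^ᵍ q) gᵈ≡ε ⟩
    ε ^ᵍ q          ≡⟨ ε^n≡ε q ⟩
    ε               ∎

  ^ᵍ-% : ∀ {g} d .{{_ : NonZero d}} → g ^ᵍ d ≡ ε → ∀ c → g ^ᵍ c ≡ g ^ᵍ (c % d)
  ^ᵍ-% {g} d gᵈ≡ε c = begin
    g ^ᵍ c                             ≡⟨ cong (g ^ᵍ_) (m≡m%n+[m/n]*n c d) ⟩
    g ^ᵍ (c % d + c / d * d)           ≡⟨ ^ᵍ-distribˡ-+ g (c % d) _ ⟩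
    g ^ᵍ (c % d) ∙ g ^ᵍ (c / d * d)    ≡⟨ cong (g ^ᵍ (c % d) ∙_) (∣⇒^ᵍ≡ε gᵈ≡ε (n∣m*n (c / d))) ⟩
    g ^ᵍ (c % d) ∙ ε                   ≡⟨ identityʳ _ ⟩
    g ^ᵍ (c % d)                       ∎

  ^ᵍ-inverse : ∀ {g} d .{{_ : NonZero d}} → g ^ᵍ d ≡ ε → ∀ m → (g ^ᵍ m) ⁻¹ ≡ g ^ᵍ (m * (d ∸ 1))
  ^ᵍ-inverse {g} d gᵈ≡ε m = sym (inverseʳ-unique (g ^ᵍ m) _ (begin
    g ^ᵍ m ∙ g ^ᵍ (m * (d ∸ 1))  ≡⟨ ^ᵍ-distribˡ-+ g m _ ⟨
    g ^ᵍ (m + m * (d ∸ 1))       ≡⟨ cong (g ^ᵍ_) (m+m*[n∸1]≡m*n m d) ⟩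
    g ^ᵍ (m * d)                 ≡⟨ ∣⇒^ᵍ≡ε gᵈ≡ε (n∣m*n m) ⟩
    ε                            ∎))

  ^ᵍ-// : ∀ {g} d .{{_ : NonZero d}} → g ^ᵍ d ≡ ε → ∀ i i′ → g ^ᵍ i ∙ (g ^ᵍ i′) ⁻¹ ≡ g ^ᵍ (i + i′ * (d ∸ 1))
  ^ᵍ-// {g} d gᵈ≡ε i i′ = trans (cong (g ^ᵍ i ∙_) (^ᵍ-inverse d gᵈ≡ε i′)) (sym (^ᵍ-distribˡ-+ g i _))

  HasOrder′ : Fin N → ℕ → Set
  HasOrder′ g d = g ^ᵍ d ≡ ε × (∀ c → g ^ᵍ c ≡ ε → d ∣ c)

  HasOrder⇒HasOrder′ : ∀ {g d} → HasOrder G g d → HasOrder′ g d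
  HasOrder⇒HasOrder′ {g} {d} (1≤d , gᵈ≡ε , minimal) = gᵈ≡ε , divides-exponent
    where
    instance
      _ : NonZero d
      _ = >-nonZero 1≤d
    divides-exponent : ∀ c → g ^ᵍ c ≡ ε → d ∣ c
    divides-exponent c gᶜ≡ε with c % d in c%d≡r
    ... | zero = m%n≡0⇒n∣m c d c%d≡r
    ... | suc r = ⊥-elim (minimal k (subst (1 ≤_) (sym k≡1+r) (s≤s z≤n)) gᵏ≡ε)
      where
      k = fromℕ< (m%n<n c d)
      k≡1+r : toℕ k ≡ suc r
      k≡1+r = trans (toℕ-fromℕ< _) c%d≡r
      gᵏ≡ε : g ^ᵍ toℕ k ≡ ε
      gᵏ≡ε = trans (cong (g ^ᵍ_) (trans k≡1+r (sym c%d≡r))) (trans (sym (^ᵍ-% d gᵈ≡ε c)) gᶜ≡ε)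

  HasOrder′⇒HasOrder : ∀ {g d} .{{_ : NonZero d}} → HasOrder′ g d → HasOrder G g d
  HasOrder′⇒HasOrder {g} {d} (gᵈ≡ε , d∣) = >-nonZero⁻¹ d , gᵈ≡ε , λ k 1≤k gᵏ≡ε →
    <⇒≱ (toℕ<n k) (∣⇒≤ {{>-nonZero 1≤k}} (d∣ (toℕ k) gᵏ≡ε))

  count-∙-translate : ∀ {A : Fin N → Set} (A? : Decidable A) a → count (λ z → A? (z ∙ a)) ≡ count A?
  count-∙-translate A? a = sym (sum-permute (λ z → χ (A? z)) translation)
    where
    translation = permutation (_∙ a) (_∙ a ⁻¹) (//-rightDividesˡ a) (//-rightDividesʳ a)

  record Subgroup : Set₁ where
    field
      Mem : Fin N → Set
      mem? : Decidable Mem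
      ε-mem : Mem ε
      ∙-mem : ∀ {x y} → Mem x → Mem y → Mem (x ∙ y)
      ⁻¹-mem : ∀ {x} → Mem x → Mem (x ⁻¹)

    size : ℕ
    size = count mem?

    ^ᵍ-mem : ∀ {x} n → Mem x → Mem (x ^ᵍ n)
    ^ᵍ-mem zero x∈ = ε-mem
    ^ᵍ-mem (suc n) x∈ = ∙-mem x∈ (^ᵍ-mem n x∈)

    ^ᵍ-*-mem : ∀ {y} i n → Mem (y ^ᵍ i) → Mem (y ^ᵍ (n * i))
    ^ᵍ-*-mem {y} i n yⁱ∈ = subst Mem (trans (^ᵍ-*-assoc y i n) (cong (y ^ᵍ_) (*-comm i n))) (^ᵍ-mem n yⁱ∈)

    ∙-mem⁻¹ : ∀ {x y} → Mem (x ∙ y) → Mem y → Mem x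
    ∙-mem⁻¹ {x} {y} xy∈ y∈ = subst Mem (//-rightDividesʳ y x) (∙-mem xy∈ (⁻¹-mem y∈))

    coprime-powers-mem : ∀ {y i j} → Coprime i j → Mem (y ^ᵍ i) → Mem (y ^ᵍ j) → Mem y
    coprime-powers-mem {y} {i} {j} i⊥j yⁱ∈ yʲ∈ with coprime-Bézout i⊥j
    ... | Bézout.+- a b 1+bj≡ai =
      ∙-mem⁻¹ (subst (Mem ∘ (y ^ᵍ_)) (sym 1+bj≡ai) (^ᵍ-*-mem i a yⁱ∈)) (^ᵍ-*-mem j b yʲ∈)
    ... | Bézout.-+ a b 1+ai≡bj =
      ∙-mem⁻¹ (subst (Mem ∘ (y ^ᵍ_)) (sym 1+ai≡bj) (^ᵍ-*-mem j b yʲ∈)) (^ᵍ-*-mem i a yⁱ∈)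

    infix 4 _∼_
    _∼_ : Fin N → Fin N → Set
    x ∼ y = Mem (x ∙ y ⁻¹)

    ∼-refl : ∀ {x} → x ∼ x
    ∼-refl {x} = subst Mem (sym (inverseʳ x)) ε-mem

    ∼-sym : ∀ {x y} → x ∼ y → y ∼ x
    ∼-sym {x} {y} x∼y = subst Mem (⁻¹-anti-homo-// x y) (⁻¹-mem x∼y)

    ∼-trans : ∀ {x y z} → x ∼ y → y ∼ z → x ∼ z
    ∼-trans {x} {y} {z} x∼y y∼z = subst Mem eq (∙-mem x∼y y∼z)
      where
      eq : x ∙ y ⁻¹ ∙ (y ∙ z ⁻¹) ≡ x ∙ z ⁻¹
      eq = trans (sym (assoc _ _ _)) (cong (_∙ z ⁻¹) (//-rightDividesˡ y x))

    ∙-∼ : ∀ {x y u v} → x ∼ y → u ∼ v → x ∙ u ∼ y ∙ v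
    ∙-∼ {x} {y} {u} {v} x∼y u∼v =
      subst Mem (trans (interchange x _ u _) (cong (x ∙ u ∙_) (⁻¹-∙-comm y v))) (∙-mem x∼y u∼v)

    ⁻¹-∼ : ∀ {x y} → x ∼ y → x ⁻¹ ∼ y ⁻¹
    ⁻¹-∼ {x} {y} x∼y = subst Mem (sym (⁻¹-∙-comm x (y ⁻¹))) (⁻¹-mem x∼y)

    ∼-∙ʳ : ∀ {x k} → Mem k → x ∼ x ∙ k
    ∼-∙ʳ {x} {k} k∈ = subst (_∼ x ∙ k) (identityʳ x) (∙-∼ ∼-refl (subst Mem (sym (identityˡ _)) (⁻¹-mem k∈)))

    ∼-∙ʳ⁻¹ : ∀ {x k} → x ∼ x ∙ k → Mem k
    ∼-∙ʳ⁻¹ {x} {k} x∼xk = subst Mem (xyx⁻¹≈y x k) (∼-sym x∼xk)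

    size-∣-invariant : ∀ {A} (A? : Decidable A) → (∀ {x k} → A x → Mem k → A (x ∙ k)) → size ∣ count A?
    size-∣-invariant A? invariant = go (count A?) A? invariant ≤-refl
      where
      go : ∀ n {A} (A? : Decidable A) → (∀ {x k} → A x → Mem k → A (x ∙ k)) → count A? ≤ n → size ∣ count A?
      go zero A? _ count≤0 = subst (size ∣_) (sym (n≤0⇒n≡0 count≤0)) (size ∣0)
      go (suc n) {A} A? invariant count≤1+n with any? A?
      ... | no ∄ = subst (size ∣_) (sym (count-zero A? (λ z a → ∄ (z , a)))) (size ∣0)
      ... | yes (x , ax) =
        subst (size ∣_) (sym split) (∣m∣n⇒∣m+n ∣-refl (go n rest? rest-invariant rest≤n))
        where
        coset? : Decidable (_∼ x)
        coset? z = mem? (z ∙ x ⁻¹)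
        rest? : Decidable (λ z → A z × ¬ z ∼ x)
        rest? z = A? z ×-dec ¬? (coset? z)
        coset⊆A : ∀ z → z ∼ x → A z
        coset⊆A z z∼x = subst A (trans (comm _ _) (//-rightDividesˡ x z)) (invariant ax z∼x)
        split : count A? ≡ size + count rest?
        split = trans (count-split A? coset?) (cong (_+ count rest?) (begin
          count (λ z → A? z ×-dec coset? z)
            ≡⟨ count-cong (λ z → A? z ×-dec coset? z) coset? (λ _ → proj₂) (λ z z∼x → coset⊆A z z∼x , z∼x) ⟩
          count coset?                      ≡⟨ count-∙-translate mem? (x ⁻¹) ⟩
          size                              ∎))
        rest≤n : count rest? ≤ n
        rest≤n = s≤s⁻¹ (≤-trans (subst (1 + count rest? ≤_) (sym split) (+-monoˡ-≤ _ (count-≥1 mem? ε ε-mem)))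
                                count≤1+n)
        rest-invariant : ∀ {z k} → A z × ¬ z ∼ x → Mem k → A (z ∙ k) × ¬ z ∙ k ∼ x
        rest-invariant (az , z≁x) k∈ = invariant az k∈ , λ zk∼x → z≁x (∼-trans (∼-∙ʳ k∈) zk∼x)

    lagrange : size ∣ N
    lagrange = subst (size ∣_) count-all (size-∣-invariant (λ _ → yes tt) (λ _ _ → tt))

  trivial : Subgroup
  trivial = record
    { Mem = _≡ ε ; mem? = _≟ ε ; ε-mem = refl
    ; ∙-mem = λ { refl refl → identityˡ ε } ; ⁻¹-mem = λ { refl → ε⁻¹≈ε } }

  prime-order : ∀ {p v} → Prime p → v ^ᵍ p ≡ ε → v ≢ ε → HasOrder′ v p
  prime-order {p} {v} p-prime vᵖ≡ε v≢ε = vᵖ≡ε , p∣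
    where
    p∣ : ∀ c → v ^ᵍ c ≡ ε → p ∣ c
    p∣ c vᶜ≡ε with p ∣? c
    ... | yes p∣c = p∣c
    ... | no p∤c = ⊥-elim (v≢ε (Subgroup.coprime-powers-mem trivial (prime∤⇒coprime p-prime p∤c) vᶜ≡ε vᵖ≡ε))

  ^ᵍ-injective-≤ : ∀ {g d a b} → HasOrder′ g d → a ≤ b → b < d → g ^ᵍ a ≡ g ^ᵍ b → a ≡ b
  ^ᵍ-injective-≤ {g} {d} {a} order a≤b b<d gᵃ≡gᵇ with m≤n⇒∃[o]m+o≡n a≤b
  ... | zero , refl = sym (+-identityʳ a)
  ... | suc o , refl = ⊥-elim (<⇒≱ (≤-<-trans (m≤n+m (suc o) a) b<d) (∣⇒≤ (proj₂ order (suc o) gᵒ≡ε)))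
    where
    gᵒ≡ε : g ^ᵍ suc o ≡ ε
    gᵒ≡ε = sym (∙-cancelˡ (g ^ᵍ a) ε _ (trans (identityʳ _) (trans gᵃ≡gᵇ (^ᵍ-distribˡ-+ g a (suc o)))))

  ^ᵍ-injective : ∀ {g d a b} → HasOrder′ g d → a < d → b < d → g ^ᵍ a ≡ g ^ᵍ b → a ≡ b
  ^ᵍ-injective {a = a} {b} order a<d b<d gᵃ≡gᵇ with ≤-total a b
  ... | inj₁ a≤b = ^ᵍ-injective-≤ order a≤b b<d gᵃ≡gᵇ
  ... | inj₂ b≤a = sym (^ᵍ-injective-≤ order b≤a a<d (sym gᵃ≡gᵇ))

  last-power-outside : (K : Subgroup) → ∀ {p} k {y} → Subgroup.Mem K (y ^ᵍ (p ^ k)) → ¬ Subgroup.Mem K y →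
    ∃ λ t → ¬ Subgroup.Mem K (y ^ᵍ t) × Subgroup.Mem K (y ^ᵍ t ^ᵍ p)
  last-power-outside K zero {y} y¹∈K y∉K = ⊥-elim (y∉K (subst (Subgroup.Mem K) (^ᵍ-identityʳ y) y¹∈K))
  last-power-outside K {p} (suc k) {y} yᵖᵏ⁺¹∈K y∉K with Subgroup.mem? K (y ^ᵍ (p ^ k))
  ... | yes yᵖᵏ∈K = last-power-outside K k yᵖᵏ∈K y∉K
  ... | no yᵖᵏ∉K = p ^ k , yᵖᵏ∉K ,
    subst (Subgroup.Mem K) (sym (trans (^ᵍ-*-assoc y (p ^ k) p) (cong (y ^ᵍ_) (*-comm (p ^ k) p)))) yᵖᵏ⁺¹∈K

  outside⇒trivial-intersection : (K : Subgroup) → ∀ {p a x} → Prime p → x ^ᵍ p ≡ ε → ¬ Subgroup.Mem K x →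
    (∀ i → Subgroup.Mem K (a ^ᵍ i)) → ∀ i j → a ^ᵍ i ≡ x ^ᵍ j → x ^ᵍ j ≡ ε
  outside⇒trivial-intersection K {p} {a} {x} p-prime xᵖ≡ε x∉K aⁱ∈K i j aⁱ≡xʲ with p ∣? j
  ... | yes p∣j = ∣⇒^ᵍ≡ε xᵖ≡ε p∣j
  ... | no p∤j = ⊥-elim (x∉K (Subgroup.coprime-powers-mem K (prime∤⇒coprime p-prime p∤j)
                               (subst (Subgroup.Mem K) aⁱ≡xʲ (aⁱ∈K i))
                               (subst (Subgroup.Mem K) (sym xᵖ≡ε) (Subgroup.ε-mem K))))

  module Adjoin (K : Subgroup) {p} (p-prime : Prime p) {y}
                (y∉K : ¬ Subgroup.Mem K y) (yᵖ∈K : Subgroup.Mem K (y ^ᵍ p)) where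
    open Subgroup K

    instance
      _ : NonZero p
      _ = prime⇒nonZero p-prime

    ^ᵍ-∼-% : ∀ c → y ^ᵍ c ∼ y ^ᵍ (c % p)
    ^ᵍ-∼-% c = subst Mem (sym eq) (^ᵍ-*-mem p (c / p) yᵖ∈K)
      where
      eq : y ^ᵍ c ∙ (y ^ᵍ (c % p)) ⁻¹ ≡ y ^ᵍ (c / p * p)
      eq = begin
        y ^ᵍ c ∙ (y ^ᵍ (c % p)) ⁻¹
          ≡⟨ cong (λ t → y ^ᵍ t ∙ (y ^ᵍ (c % p)) ⁻¹) (m≡m%n+[m/n]*n c p) ⟩
        y ^ᵍ (c % p + c / p * p) ∙ (y ^ᵍ (c % p)) ⁻¹
          ≡⟨ cong (_∙ (y ^ᵍ (c % p)) ⁻¹) (^ᵍ-distribˡ-+ y (c % p) _) ⟩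
        y ^ᵍ (c % p) ∙ y ^ᵍ (c / p * p) ∙ (y ^ᵍ (c % p)) ⁻¹    ≡⟨ xyx⁻¹≈y _ _ ⟩
        y ^ᵍ (c / p * p)                                     ∎

    ^ᵍ-⁻¹-∼ : ∀ j → (y ^ᵍ j) ⁻¹ ∼ y ^ᵍ (j * (p ∸ 1))
    ^ᵍ-⁻¹-∼ j = subst Mem eq (⁻¹-mem (^ᵍ-*-mem p j yᵖ∈K))
      where
      eq : (y ^ᵍ (j * p)) ⁻¹ ≡ (y ^ᵍ j) ⁻¹ ∙ (y ^ᵍ (j * (p ∸ 1))) ⁻¹
      eq = begin
        (y ^ᵍ (j * p)) ⁻¹                        ≡⟨ cong (λ t → (y ^ᵍ t) ⁻¹) (m+m*[n∸1]≡m*n j p) ⟨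
        (y ^ᵍ (j + j * (p ∸ 1))) ⁻¹              ≡⟨ cong _⁻¹ (^ᵍ-distribˡ-+ y j _) ⟩
        (y ^ᵍ j ∙ y ^ᵍ (j * (p ∸ 1))) ⁻¹         ≡⟨ ⁻¹-∙-comm _ _ ⟨
        (y ^ᵍ j) ⁻¹ ∙ (y ^ᵍ (j * (p ∸ 1))) ⁻¹    ∎

    ^ᵍ-∼-injective-≤ : ∀ {a b} → a ≤ b → b < p → y ^ᵍ a ∼ y ^ᵍ b → a ≡ b
    ^ᵍ-∼-injective-≤ {a} a≤b b<p yᵃ∼yᵇ with m≤n⇒∃[o]m+o≡n a≤b
    ... | zero , refl = sym (+-identityʳ a)
    ... | suc o , refl = ⊥-elim (y∉K (coprime-powers-mem p⊥o yᵒ∈K yᵖ∈K))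
      where
      p⊥o = prime∤⇒coprime p-prime (>⇒∤ (≤-<-trans (m≤n+m (suc o) a) b<p))
      yᵒ∈K = ∼-∙ʳ⁻¹ (subst (y ^ᵍ a ∼_) (^ᵍ-distribˡ-+ y a (suc o)) yᵃ∼yᵇ)

    representative-unique : ∀ z (i j : Fin p) → z ∼ y ^ᵍ toℕ i → z ∼ y ^ᵍ toℕ j → i ≡ j
    representative-unique z i j z∼yⁱ z∼yʲ with ≤-total (toℕ i) (toℕ j)
    ... | inj₁ i≤j = toℕ-injective (^ᵍ-∼-injective-≤ i≤j (toℕ<n j) (∼-trans (∼-sym z∼yⁱ) z∼yʲ))
    ... | inj₂ j≤i = sym (toℕ-injective (^ᵍ-∼-injective-≤ j≤i (toℕ<n i) (∼-trans (∼-sym z∼yʲ) z∼yⁱ)))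

    -- ⟨K, y⟩ = K ∪ yK ∪ ⋯ ∪ y^(p-1)K; these cosets are distinct because y ∉ K and p is prime.
    Mem′ : Fin N → Set
    Mem′ z = ∃ λ (j : Fin p) → z ∼ y ^ᵍ toℕ j

    reduce : ∀ {z} c → z ∼ y ^ᵍ c → Mem′ z
    reduce {z} c z∼yᶜ = fromℕ< (m%n<n c p) ,
      subst (λ t → z ∼ y ^ᵍ t) (sym (toℕ-fromℕ< (m%n<n c p))) (∼-trans z∼yᶜ (^ᵍ-∼-% c))

    adjoined : Subgroup
    adjoined = record
      { Mem = Mem′
      ; mem? = λ z → any? (λ j → mem? (z ∙ (y ^ᵍ toℕ j) ⁻¹))
      ; ε-mem = reduce 0 ∼-refl
      ; ∙-mem = λ { {x} {z} (i , x∼yⁱ) (j , z∼yʲ) →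
          reduce (toℕ i + toℕ j) (subst (x ∙ z ∼_) (sym (^ᵍ-distribˡ-+ y (toℕ i) (toℕ j))) (∙-∼ x∼yⁱ z∼yʲ)) }
      ; ⁻¹-mem = λ { (j , x∼yʲ) → reduce (toℕ j * (p ∸ 1)) (∼-trans (⁻¹-∼ x∼yʲ) (^ᵍ-⁻¹-∼ (toℕ j))) }
      }

    size-adjoined : Subgroup.size adjoined ≡ p * size
    size-adjoined = begin
      sum {N} (λ z → χ (any? (λ j → mem? (z ∙ (y ^ᵍ toℕ j) ⁻¹))))
        ≡⟨ sum-cong-≗ {N} (λ z → χ-any?-unique (λ j → mem? (z ∙ (y ^ᵍ toℕ j) ⁻¹)) (representative-unique z)) ⟩
      sum {N} (λ z → sum {p} (λ j → χ (mem? (z ∙ (y ^ᵍ toℕ j) ⁻¹))))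
        ≡⟨ ∑-comm {N} {p} (λ z j → χ (mem? (z ∙ (y ^ᵍ toℕ j) ⁻¹))) ⟩
      sum {p} (λ j → sum {N} (λ z → χ (mem? (z ∙ (y ^ᵍ toℕ j) ⁻¹))))
        ≡⟨ sum-cong-≗ {p} (λ j → count-∙-translate mem? ((y ^ᵍ toℕ j) ⁻¹)) ⟩
      sum {p} (λ _ → size)
        ≡⟨ sum-const p size ⟩
      p * size ∎

  record IndependentPair (d₁ d₂ : ℕ) : Set where
    field
      g₁ g₂ : Fin N
      g₁-order : HasOrder′ g₁ d₁
      g₂-order : HasOrder′ g₂ d₂
      trivial-intersection : ∀ i j → g₁ ^ᵍ i ≡ g₂ ^ᵍ j → g₂ ^ᵍ j ≡ ε

  -- The internal direct product ⟨g₁⟩ × ⟨g₂⟩, indexed through Fin (d₁ * d₂) ≅ Fin d₁ × Fin d₂.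
  module CyclicProduct {d₁ d₂} {{_ : NonZero d₁}} {{_ : NonZero d₂}} (P : IndependentPair d₁ d₂) where
    open IndependentPair P

    monomial : ℕ → ℕ → Fin N
    monomial i j = g₁ ^ᵍ i ∙ g₂ ^ᵍ j

    monomial-∙ : ∀ i j i′ j′ → monomial i j ∙ monomial i′ j′ ≡ monomial (i + i′) (j + j′)
    monomial-∙ i j i′ j′ =
      trans (interchange _ _ _ _) (sym (cong₂ _∙_ (^ᵍ-distribˡ-+ g₁ i i′) (^ᵍ-distribˡ-+ g₂ j j′)))

    monomial-⁻¹ : ∀ i j → (monomial i j) ⁻¹ ≡ monomial (i * (d₁ ∸ 1)) (j * (d₂ ∸ 1))
    monomial-⁻¹ i j = trans (sym (⁻¹-∙-comm _ _))
      (cong₂ _∙_ (^ᵍ-inverse d₁ (proj₁ g₁-order) i) (^ᵍ-inverse d₂ (proj₁ g₂-order) j))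

    monomial-^ᵍ : ∀ i j c → monomial i j ^ᵍ c ≡ monomial (i * c) (j * c)
    monomial-^ᵍ i j c = trans (^ᵍ-distribʳ-∙ _ _ c) (cong₂ _∙_ (^ᵍ-*-assoc g₁ i c) (^ᵍ-*-assoc g₂ j c))

    monomial≡ε⇒ : ∀ i j → monomial i j ≡ ε → g₁ ^ᵍ i ≡ ε × g₂ ^ᵍ j ≡ ε
    monomial≡ε⇒ i j g₁ⁱg₂ʲ≡ε = g₁ⁱ≡ε , g₂ʲ≡ε
      where
      g₁ⁱ≡g₂ᵏ : g₁ ^ᵍ i ≡ g₂ ^ᵍ (j * (d₂ ∸ 1))
      g₁ⁱ≡g₂ᵏ = trans (inverseˡ-unique _ _ g₁ⁱg₂ʲ≡ε) (^ᵍ-inverse d₂ (proj₁ g₂-order) j)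
      g₁ⁱ≡ε = trans g₁ⁱ≡g₂ᵏ (trivial-intersection i (j * (d₂ ∸ 1)) g₁ⁱ≡g₂ᵏ)
      g₂ʲ≡ε = trans (inverseʳ-unique _ _ g₁ⁱg₂ʲ≡ε) (trans (cong _⁻¹ g₁ⁱ≡ε) ε⁻¹≈ε)

    monomial-injective : ∀ {i j i′ j′} → monomial i j ≡ monomial i′ j′ → g₁ ^ᵍ i ≡ g₁ ^ᵍ i′ × g₂ ^ᵍ j ≡ g₂ ^ᵍ j′
    monomial-injective {i} {j} {i′} {j′} eq =
        x∙y⁻¹≈ε⇒x≈y _ _ (trans (^ᵍ-// d₁ (proj₁ g₁-order) i i′) (proj₁ quotient≡ε))
      , x∙y⁻¹≈ε⇒x≈y _ _ (trans (^ᵍ-// d₂ (proj₁ g₂-order) j j′) (proj₂ quotient≡ε))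
      where
      quotient≡ε = monomial≡ε⇒ (i + i′ * (d₁ ∸ 1)) (j + j′ * (d₂ ∸ 1)) (begin
        monomial (i + i′ * (d₁ ∸ 1)) (j + j′ * (d₂ ∸ 1))  ≡⟨ monomial-∙ i j _ _ ⟨
        monomial i j ∙ monomial (i′ * (d₁ ∸ 1)) (j′ * (d₂ ∸ 1))  ≡⟨ cong (monomial i j ∙_) (monomial-⁻¹ i′ j′) ⟨
        monomial i j ∙ (monomial i′ j′) ⁻¹               ≡⟨ x≈y⇒x∙y⁻¹≈ε eq ⟩
        ε                                               ∎)

    monomial-^ᵍ≡ε⇔ : ∀ i j c → monomial i j ^ᵍ c ≡ ε ⇔ (d₁ ∣ i * c × d₂ ∣ j * c)
    monomial-^ᵍ≡ε⇔ i j c = mk⇔ to from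
      where
      to : monomial i j ^ᵍ c ≡ ε → d₁ ∣ i * c × d₂ ∣ j * c
      to e with monomial≡ε⇒ (i * c) (j * c) (trans (sym (monomial-^ᵍ i j c)) e)
      ... | g₁ⁱᶜ≡ε , g₂ʲᶜ≡ε = proj₂ g₁-order _ g₁ⁱᶜ≡ε , proj₂ g₂-order _ g₂ʲᶜ≡ε
      from : d₁ ∣ i * c × d₂ ∣ j * c → monomial i j ^ᵍ c ≡ ε
      from (d₁∣ , d₂∣) = trans (monomial-^ᵍ i j c)
        (trans (cong₂ _∙_ (∣⇒^ᵍ≡ε (proj₁ g₁-order) d₁∣) (∣⇒^ᵍ≡ε (proj₁ g₂-order) d₂∣)) (identityˡ ε))

    first second : Fin (d₁ * d₂) → ℕ
    first k = toℕ (proj₁ (remQuot {d₁} d₂ k))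
    second k = toℕ (proj₂ (remQuot {d₁} d₂ k))

    embed : Fin (d₁ * d₂) → Fin N
    embed k = monomial (first k) (second k)

    embed-injective : ∀ k k′ → embed k ≡ embed k′ → k ≡ k′
    embed-injective k k′ eq = begin
      k                                    ≡⟨ combine-remQuot {d₁} d₂ k ⟨
      uncurry combine (remQuot {d₁} d₂ k)  ≡⟨ cong (uncurry combine) same-quotient ⟩
      uncurry combine (remQuot {d₁} d₂ k′) ≡⟨ combine-remQuot {d₁} d₂ k′ ⟩
      k′                                   ∎
      where
      powers = monomial-injective {first k} {second k} {first k′} {second k′} eq
      same-quotient : remQuot {d₁} d₂ k ≡ remQuot {d₁} d₂ k′
      same-quotient = cong₂ _,_
        (toℕ-injective (^ᵍ-injective g₁-order (toℕ<n _) (toℕ<n _) (proj₁ powers)))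
        (toℕ-injective (^ᵍ-injective g₂-order (toℕ<n _) (toℕ<n _) (proj₂ powers)))

    monomial-image : ∀ i j → Image embed (monomial i j)
    monomial-image i j = combine i′ j′ , (begin
      monomial i j
        ≡⟨ cong₂ _∙_ (^ᵍ-% d₁ (proj₁ g₁-order) i) (^ᵍ-% d₂ (proj₁ g₂-order) j) ⟩
      monomial (i % d₁) (j % d₂)
        ≡⟨ cong₂ monomial (toℕ-fromℕ< (m%n<n i d₁)) (toℕ-fromℕ< (m%n<n j d₂)) ⟨
      monomial (toℕ i′) (toℕ j′)
        ≡⟨ cong (λ q → monomial (toℕ (proj₁ q)) (toℕ (proj₂ q))) (remQuot-combine i′ j′) ⟨
      embed (combine i′ j′)                       ∎)
      where
      i′ = fromℕ< (m%n<n i d₁)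
      j′ = fromℕ< (m%n<n j d₂)

    span : Subgroup
    span = record
      { Mem = Image embed
      ; mem? = image? embed
      ; ε-mem = subst (Image embed) (identityˡ ε) (monomial-image 0 0)
      ; ∙-mem = λ { (k , refl) (k′ , refl) →
          subst (Image embed) (sym (monomial-∙ (first k) (second k) (first k′) (second k′)))
                (monomial-image (first k + first k′) (second k + second k′)) }
      ; ⁻¹-mem = λ { (k , refl) → subst (Image embed) (sym (monomial-⁻¹ (first k) (second k)))
                                         (monomial-image (first k * (d₁ ∸ 1)) (second k * (d₂ ∸ 1))) }
      }

    size-span : Subgroup.size span ≡ d₁ * d₂
    size-span = count-image embed embed-injective

    g₁^ᵍ∈span : ∀ i → Subgroup.Mem span (g₁ ^ᵍ i)
    g₁^ᵍ∈span i = subst (Image embed) (identityʳ _) (monomial-image i 0)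

  ε-order : HasOrder′ ε 1
  ε-order = ε^n≡ε 1 , λ c _ → 1∣ c

  cyclic-pair : ∀ {g d} → HasOrder′ g d → IndependentPair d 1
  cyclic-pair {g} g-order = record
    { g₁ = g ; g₂ = ε ; g₁-order = g-order ; g₂-order = ε-order ; trivial-intersection = λ _ j _ → ε^n≡ε j }

  HasOrder′-^ᵍ : ∀ {h} p d .{{_ : NonZero p}} → HasOrder′ h (p * d) → HasOrder′ (h ^ᵍ p) d
  HasOrder′-^ᵍ {h} p d (hᵖᵈ≡ε , pd∣) = trans (^ᵍ-*-assoc h p d) hᵖᵈ≡ε ,
    λ c hᵖᶜ≡ε → *-cancelˡ-∣ p (pd∣ (p * c) (trans (sym (^ᵍ-*-assoc h p c)) hᵖᶜ≡ε))

  p*size∣N : (K : Subgroup) → ∀ {p} → Prime p → ∀ k {y} → ¬ Subgroup.Mem K y → Subgroup.Mem K (y ^ᵍ p ^ k) →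
    p * Subgroup.size K ∣ N
  p*size∣N K {p} p-prime k y∉K yᵖᵏ∈K with last-power-outside K k yᵖᵏ∈K y∉K
  ... | t , yᵗ∉K , yᵗᵖ∈K = subst (_∣ N) size-adjoined (Subgroup.lagrange adjoined)
    where open Adjoin K p-prime yᵗ∉K yᵗᵖ∈K

  module _ {p} (p-prime : Prime p) (s₁ : ℕ) {g} (g-order : HasOrder′ g (p ^ suc s₁)) where

    instance
      _ : NonZero p
      _ = prime⇒nonZero p-prime
      _ : NonZero (p ^ s₁)
      _ = m^n≢0 p s₁
      _ : NonZero (p ^ suc s₁)
      _ = m^n≢0 p (suc s₁)

    open CyclicProduct (cyclic-pair g-order) using (span; first; second; g₁^ᵍ∈span)
    open Subgroup span

    -- w^p = g^i with p ∣ i because w^(p^s) = ε, so w g^(-i/p) is p-torsion.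
    p-torsion⊆⟨g⟩⇒root∈⟨g⟩ : (∀ v → v ^ᵍ p ≡ ε → Mem v) → ∀ w → w ^ᵍ p ^ suc s₁ ≡ ε → Mem (w ^ᵍ p) → Mem w
    p-torsion⊆⟨g⟩⇒root∈⟨g⟩ p-torsion⊆ w wᵖˢ≡ε (k , wᵖ≡) = ∙-mem⁻¹ (p-torsion⊆ _ vᵖ≡ε) (⁻¹-mem (g₁^ᵍ∈span a))
      where
      i = first k
      wᵖ≡gⁱ : w ^ᵍ p ≡ g ^ᵍ i
      wᵖ≡gⁱ = trans wᵖ≡ (trans (cong (g ^ᵍ i ∙_) (ε^n≡ε (second k))) (identityʳ _))
      p∣i : p ∣ i
      p∣i = *-cancelʳ-∣ {p} {i} (p ^ s₁) (proj₂ g-order (i * p ^ s₁) (begin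
        g ^ᵍ (i * p ^ s₁)       ≡⟨ ^ᵍ-*-assoc g i (p ^ s₁) ⟨
        g ^ᵍ i ^ᵍ p ^ s₁        ≡⟨ cong (_^ᵍ p ^ s₁) wᵖ≡gⁱ ⟨
        w ^ᵍ p ^ᵍ p ^ s₁        ≡⟨ ^ᵍ-*-assoc w p (p ^ s₁) ⟩
        w ^ᵍ p ^ suc s₁         ≡⟨ wᵖˢ≡ε ⟩
        ε                       ∎))
      a = quotient p∣i
      vᵖ≡ε : (w ∙ (g ^ᵍ a) ⁻¹) ^ᵍ p ≡ ε
      vᵖ≡ε = begin
        (w ∙ (g ^ᵍ a) ⁻¹) ^ᵍ p            ≡⟨ ^ᵍ-distribʳ-∙ w _ p ⟩
        w ^ᵍ p ∙ (g ^ᵍ a) ⁻¹ ^ᵍ p         ≡⟨ cong (w ^ᵍ p ∙_) (⁻¹-^ᵍ-comm (g ^ᵍ a) p) ⟩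
        w ^ᵍ p ∙ (g ^ᵍ a ^ᵍ p) ⁻¹         ≡⟨ cong (λ u → w ^ᵍ p ∙ u ⁻¹) (^ᵍ-*-assoc g a p) ⟩
        w ^ᵍ p ∙ (g ^ᵍ (a * p)) ⁻¹        ≡⟨ cong (λ u → w ^ᵍ p ∙ (g ^ᵍ u) ⁻¹) (_∣_.equality p∣i) ⟨
        w ^ᵍ p ∙ (g ^ᵍ i) ⁻¹              ≡⟨ x≈y⇒x∙y⁻¹≈ε wᵖ≡gⁱ ⟩
        ε                                 ∎

    p-torsion⊆⟨g⟩⇒pˢ-torsion⊆⟨g⟩ : (∀ v → v ^ᵍ p ≡ ε → Mem v) → ∀ y → y ^ᵍ p ^ suc s₁ ≡ ε → Mem y
    p-torsion⊆⟨g⟩⇒pˢ-torsion⊆⟨g⟩ p-torsion⊆ y yᵖˢ≡ε with mem? y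
    ... | yes y∈ = y∈
    ... | no y∉ with last-power-outside span {p} (suc s₁) (subst Mem (sym yᵖˢ≡ε) ε-mem) y∉
    ...   | t , yᵗ∉ , yᵗᵖ∈ = ⊥-elim (yᵗ∉ (p-torsion⊆⟨g⟩⇒root∈⟨g⟩ p-torsion⊆ (y ^ᵍ t) yᵗᵖˢ≡ε yᵗᵖ∈))
      where
      yᵗᵖˢ≡ε : y ^ᵍ t ^ᵍ p ^ suc s₁ ≡ ε
      yᵗᵖˢ≡ε = trans (^ᵍ-comm y t (p ^ suc s₁)) (trans (cong (_^ᵍ t) yᵖˢ≡ε) (ε^n≡ε t))

  HasOrder-^1⇒HasOrder′ : ∀ {x p} → HasOrder G x (p ^ 1) → HasOrder′ x p
  HasOrder-^1⇒HasOrder′ {x} {p} x-order = subst (HasOrder′ x) (*-identityʳ p) (HasOrder⇒HasOrder′ x-order)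

  extend-cyclic-pair : ∀ {p g d} {{_ : NonZero d}} → Prime p → (g-order : HasOrder′ g d) →
    ∀ {x} → HasOrder′ x p →
    ¬ Subgroup.Mem (CyclicProduct.span (cyclic-pair g-order)) x → IndependentPair d p
  extend-cyclic-pair {g = g} p-prime g-order {x} x-order x∉⟨g⟩ = record
    { g₁ = g ; g₂ = x ; g₁-order = g-order ; g₂-order = x-order
    ; trivial-intersection = outside⇒trivial-intersection span p-prime (proj₁ x-order) x∉⟨g⟩ g₁^ᵍ∈span }
    where open CyclicProduct (cyclic-pair g-order)

-- Comparing element orders in two groups

φ≡count : ∀ {n} (G : FinAbGroup n) d → φ G d ≡ count (hasOrder? G d)
φ≡count G d = length-filter-tabulate (hasOrder? G d) id

element-of-order : ∀ {n} (G : FinAbGroup n) {d} → 0 < φ G d → ∃ λ z → HasOrder G z d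
element-of-order G {d} 0<φ = count-pos (hasOrder? G d) (subst (0 <_) (φ≡count G d) 0<φ)

module _ {n m} {G : FinAbGroup n} {H : FinAbGroup m} where

  private
    εᴳ = FinAbGroup.ε G
    εᴴ = FinAbGroup.ε H

  HasOrder-cong : ∀ {z w} → (∀ c → pow G z c ≡ εᴳ ⇔ pow H w c ≡ εᴴ) → ∀ d → HasOrder G z d ⇔ HasOrder H w d
  HasOrder-cong {z} {w} same d = mk⇔ (transfer to from) (transfer from to)
    where
    to = λ c → Equivalence.to (same c)
    from = λ c → Equivalence.from (same c)
    transfer : ∀ {n′ m′} {G′ : FinAbGroup n′} {H′ : FinAbGroup m′} {z′ w′} →
      (∀ c → pow G′ z′ c ≡ FinAbGroup.ε G′ → pow H′ w′ c ≡ FinAbGroup.ε H′) →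
      (∀ c → pow H′ w′ c ≡ FinAbGroup.ε H′ → pow G′ z′ c ≡ FinAbGroup.ε G′) →
      HasOrder G′ z′ d → HasOrder H′ w′ d
    transfer ⇒ ⇐ (1≤d , z′ᵈ≡ε , minimal) = 1≤d , ⇒ d z′ᵈ≡ε , λ k 1≤k w′ᵏ≡ε → minimal k 1≤k (⇐ (toℕ k) w′ᵏ≡ε)

  record Correspondence : Set where
    field
      size : ℕ
      left : Fin size → Fin n
      right : Fin size → Fin m
      left-injective : ∀ k k′ → left k ≡ left k′ → k ≡ k′
      right-injective : ∀ k k′ → right k ≡ right k′ → k ≡ k′
      annihilators : ∀ k c → pow G (left k) c ≡ εᴳ ⇔ pow H (right k) c ≡ εᴴ

    order∩left? : ∀ d → Decidable (λ z → HasOrder G z d × Image left z)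
    order∩left? d z = hasOrder? G d z ×-dec image? left z

    order∩right? : ∀ d → Decidable (λ w → HasOrder H w d × Image right w)
    order∩right? d w = hasOrder? H d w ×-dec image? right w

    count-order∩image : ∀ d → count (order∩left? d) ≡ count (order∩right? d)
    count-order∩image d = begin
      count (order∩left? d)                    ≡⟨ count-∩-image left left-injective (hasOrder? G d) ⟩
      sum (λ k → χ (hasOrder? G d (left k)))   ≡⟨ sum-cong-≗ (λ k → χ-cong (to k) (from k) _ _) ⟩
      sum (λ k → χ (hasOrder? H d (right k)))  ≡⟨ count-∩-image right right-injective (hasOrder? H d) ⟨
      count (order∩right? d)                   ∎
      where
      open ≡-Reasoning
      to = λ k → Equivalence.to (HasOrder-cong (annihilators k) d)
      from = λ k → Equivalence.from (HasOrder-cong (annihilators k) d)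

    φ-≤ : ∀ d → (∀ z → HasOrder G z d → Image left z) → φ G d ≤ φ H d
    φ-≤ d order-d⊆image = begin
      φ G d                   ≡⟨ φ≡count G d ⟩
      count (hasOrder? G d)   ≡⟨ count-cong (hasOrder? G d) (order∩left? d) (λ z o → o , order-d⊆image z o) (λ _ → proj₁) ⟩
      count (order∩left? d)   ≡⟨ count-order∩image d ⟩
      count (order∩right? d)  ≤⟨ count-mono (order∩right? d) (hasOrder? H d) (λ _ → proj₁) ⟩
      count (hasOrder? H d)   ≡⟨ φ≡count H d ⟨
      φ H d                   ∎
      where open ≤-Reasoning

    order-outside-image : ∀ d → φ G d ≡ φ H d →
      (∃ λ z → HasOrder G z d × ¬ Image left z) → ∃ λ w → HasOrder H w d × ¬ Image right w
    order-outside-image d φ≡ (z , z-order , z∉) =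
      count-pos outsideᴴ? (subst (0 <_) outside≡ (count-≥1 outsideᴳ? z (z-order , z∉)))
      where
      outsideᴳ? : Decidable (λ z → HasOrder G z d × ¬ Image left z)
      outsideᴳ? z = hasOrder? G d z ×-dec ¬? (image? left z)
      outsideᴴ? : Decidable (λ w → HasOrder H w d × ¬ Image right w)
      outsideᴴ? w = hasOrder? H d w ×-dec ¬? (image? right w)
      outside≡ : count outsideᴳ? ≡ count outsideᴴ?
      outside≡ = +-cancelˡ-≡ (count (order∩left? d)) _ _ (begin
        count (order∩left? d) + count outsideᴳ?   ≡⟨ count-split (hasOrder? G d) (image? left) ⟨
        count (hasOrder? G d)                     ≡⟨ φ≡count G d ⟨
        φ G d                                     ≡⟨ φ≡ ⟩
        φ H d                                     ≡⟨ φ≡count H d ⟩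
        count (hasOrder? H d)                     ≡⟨ count-split (hasOrder? H d) (image? right) ⟩
        count (order∩right? d) + count outsideᴴ?  ≡⟨ cong (_+ count outsideᴴ?) (count-order∩image d) ⟨
        count (order∩left? d) + count outsideᴴ?   ∎)
        where open ≡-Reasoning

  product-correspondence : ∀ {d₁ d₂} {{_ : NonZero d₁}} {{_ : NonZero d₂}} →
    GroupTheory.IndependentPair G d₁ d₂ → GroupTheory.IndependentPair H d₁ d₂ → Correspondence
  product-correspondence {d₁} {d₂} Pᴳ Pᴴ = record
    { size = d₁ * d₂
    ; left = Pᴳ.embed
    ; right = Pᴴ.embed
    ; left-injective = Pᴳ.embed-injective
    ; right-injective = Pᴴ.embed-injective
    ; annihilators = λ k c → ⇔.trans (Pᴳ.monomial-^ᵍ≡ε⇔ (Pᴳ.first k) (Pᴳ.second k) c)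
                                     (⇔.sym (Pᴴ.monomial-^ᵍ≡ε⇔ (Pᴴ.first k) (Pᴴ.second k) c))
    }
    where
    module Pᴳ = GroupTheory.CyclicProduct G Pᴳ
    module Pᴴ = GroupTheory.CyclicProduct H Pᴴ

module Argument {n m} {G : FinAbGroup n} {H : FinAbGroup m} {p} (p-prime : Prime p) (s₁ : ℕ) {g h}
  (g-order : GroupTheory.HasOrder′ G g (p ^ suc s₁)) (h-order : GroupTheory.HasOrder′ H h (p ^ suc (suc s₁)))
  (φp≡ : φ G (p ^ 1) ≡ φ H (p ^ 1)) (φpˢ< : φ H (p ^ suc s₁) < φ G (p ^ suc s₁)) where

  private
    module 𝔾 = GroupTheory G
    module ℍ = GroupTheory H
    s = suc s₁
    instance
      _ : NonZero p
      _ = prime⇒nonZero p-prime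
      _ : NonZero (p ^ 1)
      _ = m^n≢0 p 1
      _ : NonZero (p ^ s)
      _ = m^n≢0 p s

  ⟨g⟩ : 𝔾.IndependentPair (p ^ s) 1
  ⟨g⟩ = 𝔾.cyclic-pair g-order
  ⟨b⟩ : ℍ.IndependentPair (p ^ s) 1
  ⟨b⟩ = ℍ.cyclic-pair (ℍ.HasOrder′-^ᵍ p (p ^ s) h-order)
  module ⟨g⟩ = 𝔾.CyclicProduct ⟨g⟩
  module ⟨b⟩ = ℍ.CyclicProduct ⟨b⟩

  p-order-outside-⟨g⟩ : ∃ λ x → HasOrder G x (p ^ 1) × ¬ Image ⟨g⟩.embed x
  p-order-outside-⟨g⟩ with any? (λ z → hasOrder? G (p ^ 1) z ×-dec ¬? (image? ⟨g⟩.embed z))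
  ... | yes found = found
  ... | no none = ⊥-elim (<⇒≱ φpˢ< (Correspondence.φ-≤ (product-correspondence ⟨g⟩ ⟨b⟩) (p ^ s) order-pˢ⊆⟨g⟩))
    where
    p-torsion⊆⟨g⟩ : ∀ v → v 𝔾.^ᵍ p ≡ 𝔾.ε → Image ⟨g⟩.embed v
    p-torsion⊆⟨g⟩ v vᵖ≡ε = decidable-stable (image? ⟨g⟩.embed v) λ v∉ →
      none (v , 𝔾.HasOrder′⇒HasOrder (subst (𝔾.HasOrder′ v) (sym (*-identityʳ p))
                  (𝔾.prime-order p-prime vᵖ≡ε λ { refl → v∉ (𝔾.Subgroup.ε-mem ⟨g⟩.span) })) , v∉)
    order-pˢ⊆⟨g⟩ : ∀ z → HasOrder G z (p ^ s) → Image ⟨g⟩.embed z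
    order-pˢ⊆⟨g⟩ z (_ , zᵖˢ≡ε , _) = 𝔾.p-torsion⊆⟨g⟩⇒pˢ-torsion⊆⟨g⟩ p-prime s₁ g-order p-torsion⊆⟨g⟩ z zᵖˢ≡ε

  p-order-outside-⟨b⟩ : ∃ λ x′ → HasOrder H x′ (p ^ 1) × ¬ Image ⟨b⟩.embed x′
  p-order-outside-⟨b⟩ =
    Correspondence.order-outside-image (product-correspondence ⟨g⟩ ⟨b⟩) (p ^ 1) φp≡ p-order-outside-⟨g⟩

  ⟨g,x⟩ : 𝔾.IndependentPair (p ^ s) p
  ⟨g,x⟩ = 𝔾.extend-cyclic-pair p-prime g-order (𝔾.HasOrder-^1⇒HasOrder′ (proj₁ (proj₂ p-order-outside-⟨g⟩)))
    (proj₂ (proj₂ p-order-outside-⟨g⟩))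

  ⟨b,x′⟩ : ℍ.IndependentPair (p ^ s) p
  ⟨b,x′⟩ = ℍ.extend-cyclic-pair p-prime (ℍ.HasOrder′-^ᵍ p (p ^ s) h-order)
    (ℍ.HasOrder-^1⇒HasOrder′ (proj₁ (proj₂ p-order-outside-⟨b⟩))) (proj₂ (proj₂ p-order-outside-⟨b⟩))

  module ⟨g,x⟩ = 𝔾.CyclicProduct ⟨g,x⟩
  module ⟨b,x′⟩ = ℍ.CyclicProduct ⟨b,x′⟩

  p*size≡p^[2+s] : ∀ {size} → size ≡ p ^ s * p → p * size ≡ p ^ (2 + s)
  p*size≡p^[2+s] size≡ = cong (p *_) (trans size≡ (*-comm (p ^ s) p))

  p^[2+s]∣m : p ^ (2 + s) ∣ m
  p^[2+s]∣m = subst (_∣ m) (p*size≡p^[2+s] ⟨b,x′⟩.size-span) (ℍ.p*size∣N ⟨b,x′⟩.span p-prime 1 h∉ hᵖ∈)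
    where
    open ℍ.Subgroup ⟨b,x′⟩.span
    pˢ-torsion : ∀ z → Mem z → z ℍ.^ᵍ p ^ s ≡ ℍ.ε
    pˢ-torsion _ (k , refl) =
      Equivalence.from (⟨b,x′⟩.monomial-^ᵍ≡ε⇔ (⟨b,x′⟩.first k) (⟨b,x′⟩.second k) (p ^ s))
      (n∣m*n (⟨b,x′⟩.first k) , ∣-trans (m∣m*n (p ^ s₁)) (n∣m*n (⟨b,x′⟩.second k)))
    h∉ : ¬ Mem h
    h∉ h∈ = nonTrivial⇒≢1 {{prime⇒nonTrivial p-prime}} (∣1⇒≡1 (*-cancelʳ-∣ (p ^ s)
      (subst (p * p ^ s ∣_) (sym (*-identityˡ _)) (proj₂ h-order (p ^ s) (pˢ-torsion h h∈)))))
    hᵖ∈ : Mem (h ℍ.^ᵍ p ^ 1)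
    hᵖ∈ = subst Mem (ℍ.^ᵍ-*-assoc h p 1) (⟨b,x′⟩.g₁^ᵍ∈span 1)

  p^[2+s]∣n : p ^ (2 + s) ∣ n
  p^[2+s]∣n with any? (λ z → hasOrder? G (p ^ s) z ×-dec ¬? (image? ⟨g,x⟩.embed z))
  ... | no none = ⊥-elim (<⇒≱ φpˢ< (Correspondence.φ-≤ (product-correspondence ⟨g,x⟩ ⟨b,x′⟩) (p ^ s)
                    λ z z-order → decidable-stable (image? ⟨g,x⟩.embed z) λ z∉ → none (z , z-order , z∉)))
  ... | yes (z , (_ , zᵖˢ≡ε , _) , z∉) = subst (_∣ n) (p*size≡p^[2+s] ⟨g,x⟩.size-span)
    (𝔾.p*size∣N ⟨g,x⟩.span p-prime s z∉ (subst (Image ⟨g,x⟩.embed) (sym zᵖˢ≡ε) (𝔾.Subgroup.ε-mem ⟨g,x⟩.span)))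

lemma2p5 : (n m : ℕ) (G : FinAbGroup n) (H : FinAbGroup m)
    (p : ℕ) → Prime p →
    (α n′ γ m′ : ℕ) → n ≡ p ^ α * n′ → m ≡ p ^ γ * m′ →
    Coprime n′ p → Coprime m′ p →
    (s : ℕ) →
    p ^ s ∣ gcd m n → ¬ (φ G (p ^ s) ≡ φ H (p ^ s)) →
    ((k : ℕ) → 1 ≤ k → k < s → p ^ k ∣ gcd m n → φ G (p ^ k) ≡ φ H (p ^ k)) →
    2 ≤ s →
    p ^ (s + 1) ∣ gcd m n →
    φ H (p ^ s) < φ G (p ^ s) →
    φ G (p ^ (s + 1)) < φ H (p ^ (s + 1)) →
    (s + 2 ≤ α) × (s + 2 ≤ γ)
lemma2p5 n m G H p p-prime α n′ γ m′ n≡ m≡ n′⊥p m′⊥p (suc s₁) pˢ∣gcd _ minimal (s≤s 1≤s₁) _ φpˢ< φpˢ⁺¹< =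
    pᵏ∣pᵅ*n′⇒k≤α p-prime n′⊥p (s + 2) α (subst₂ (λ e → p ^ e ∣_) (+-comm 2 s) n≡ p^[2+s]∣n)
  , pᵏ∣pᵅ*n′⇒k≤α p-prime m′⊥p (s + 2) γ (subst₂ (λ e → p ^ e ∣_) (+-comm 2 s) m≡ p^[2+s]∣m)
  where
  s = suc s₁
  ∃g = element-of-order G (≤-<-trans z≤n φpˢ<)
  ∃h = element-of-order H (≤-<-trans z≤n φpˢ⁺¹<)
  p∣gcd : p ^ 1 ∣ gcd m n
  p∣gcd = ∣-trans (*-monoʳ-∣ p (1∣ _)) pˢ∣gcd
  open Argument p-prime s₁ (GroupTheory.HasOrder⇒HasOrder′ G (proj₂ ∃g))
    (GroupTheory.HasOrder⇒HasOrder′ H (subst (HasOrder H (proj₁ ∃h) ∘ (p ^_)) (+-comm s 1) (proj₂ ∃h)))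
    (minimal 1 ≤-refl (s≤s 1≤s₁) p∣gcd) φpˢ<
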